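{- Let $S$ be a Boolean sublattice all of whose quarks have size $2$. If $S$ is an HFS, then: (1) the pairing graph $\mathcal{G}_p(S)$ contains no path of length $5$; (2) if a connected component $C$ of $\mathcal{G}_p(S)$ contains a cycle of length $3$, then $C$ is the cycle graph $C_3$ on $3$ vertices; (3) if a connected component $C$ of $\mathcal{G}_p(S)$ contains a cycle of length $5$, then $C$ is the cycle graph $C_5$ on $5$ vertices.
   Context: Let $B_{\mathbb{N}}$ be the set of all finite subsets of $\mathbb{N}=\{1,2,3,\dots\}$, ordered by inclusion. A Boolean sublattice is a subset $S\subseteq B_{\mathbb{N}}$ containing $\emptyset$ and closed under finite unions. A quark of $S$ is a nonempty $A\in S$ such that no $B\in S$ satisfies $\emptyset\subsetneq B\subsetneq A$; $\mathcal{A}(S)$ is the set of quarks. For nonempty $X\in S$, a factorization of $X$ in $S$ is a finite set $z\subseteq\mathcal{A}(S)$ with $\bigcup z=X$ and $\bigcup z'\subsetneq X$ for every proper subset $z'\subsetneq z$; $\mathsf{L}(X)$ is the set of sizes of factorizations of $X$. $S$ is an HFS if $\mathsf{L}(X)$ is a singleton for every nonempty $X\in S$. The pairing graph $\mathcal{G}_p(S)$ is the simple graph with vertex set $\mathbb{N}$ and an edge between distinct $a,b$ whenever $\{a,b\}\in\mathcal{A}(S)$. A path of length $\ell$ has $\ell$ edges and $\ell+1$ distinct vertices; a cycle of length $\ell$ has $\ell$ edges through $\ell$ distinct vertices. -}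

module Defs where

open import Data.Nat using (ℕ; zero; suc; _+_; _%_; NonZero)
open import Data.Nat.DivMod using (m%n<n)
open import Data.Fin using (Fin; toℕ; fromℕ<; inject₁) renaming (suc to fsuc)
open import Data.List using (List; []; _∷_; _++_; concat; length)
open import Data.List.Membership.Propositional using (_∈_)
open import Data.List.Relation.Unary.All using (All)
open import Data.List.Relation.Unary.Any using (Any)
open import Data.List.Relation.Unary.AllPairs using (AllPairs)
open import Data.Product using (Σ; ∃; _×_; _,_)
open import Relation.Nullary using (¬_)
open import Relation.Binary.PropositionalEquality using (_≡_; _≢_)
open import Relation.Binary.Construct.Closure.ReflexiveTransitive using (Star)
open import Function.Definitions using (Injective)

-- Finite subsets of ℕ, represented by lists, up to extensional equality.

FinSub : Set
FinSub = List ℕ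

_⊆ˢ_ : FinSub → FinSub → Set
A ⊆ˢ B = ∀ x → x ∈ A → x ∈ B

_≐_ : FinSub → FinSub → Set
A ≐ B = A ⊆ˢ B × B ⊆ˢ A

_⊊ˢ_ : FinSub → FinSub → Set
A ⊊ˢ B = A ⊆ˢ B × ¬ (A ≐ B)

∅ : FinSub
∅ = []

_∪_ : FinSub → FinSub → FinSub
A ∪ B = A ++ B

Nonempty : FinSub → Set
Nonempty A = ∃ λ x → x ∈ A

HasSize2 : FinSub → Set
HasSize2 A = Σ ℕ λ a → Σ ℕ λ b → a ≢ b × A ≐ (a ∷ b ∷ [])

-- Boolean sublattices of B_ℕ (ℕ = {1,2,3,...})

-- a subset of B_ℕ is a predicate on represented finite sets that only
-- depends on the represented set
record BooleanSublattice (S : FinSub → Set) : Set where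
  field
    respects : ∀ A B → A ≐ B → S A → S B
    positive : ∀ A → S A → All (λ x → NonZero x) A
    hasEmpty : S ∅
    closed∪  : ∀ A B → S A → S B → S (A ∪ B)

Quark : (FinSub → Set) → FinSub → Set
Quark S A = S A × Nonempty A ×
  ¬ (Σ FinSub λ B → S B × (∅ ⊊ˢ B) × (B ⊊ˢ A))

-- Finite sets of finite sets (lists, up to ≐ on members)

_∈̃_ : FinSub → List FinSub → Set
A ∈̃ z = Any (A ≐_) z

_⊑_ : List FinSub → List FinSub → Set
z′ ⊑ z = ∀ A → A ∈̃ z′ → A ∈̃ z

_⊏_ : List FinSub → List FinSub → Set
z′ ⊏ z = z′ ⊑ z × ¬ (z ⊑ z′)

⋃ : List FinSub → FinSub
⋃ z = concat z

-- z is a factorization of X in S; z lists distinct sets, so |z| = length z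
Factorization : (FinSub → Set) → FinSub → List FinSub → Set
Factorization S X z =
  AllPairs (λ A B → ¬ (A ≐ B)) z ×
  All (Quark S) z ×
  ⋃ z ≐ X ×
  (∀ z′ → z′ ⊏ z → ⋃ z′ ⊊ˢ X)

InL : (FinSub → Set) → FinSub → ℕ → Set
InL S X n = Σ (List FinSub) λ z → Factorization S X z × length z ≡ n

LSingleton : (FinSub → Set) → FinSub → Set
LSingleton S X = Σ ℕ λ n → InL S X n × (∀ m → InL S X m → m ≡ n)

IsHFS : (FinSub → Set) → Set
IsHFS S = ∀ X → S X → Nonempty X → LSingleton S X

Edge : (FinSub → Set) → ℕ → ℕ → Set
Edge S a b = a ≢ b × Quark S (a ∷ b ∷ [])

Connected : (FinSub → Set) → ℕ → ℕ → Set
Connected S = Star (Edge S)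

IsPath : (FinSub → Set) → (ℓ : ℕ) → (Fin (suc ℓ) → ℕ) → Set
IsPath S ℓ v = Injective _≡_ _≡_ v × (∀ (i : Fin ℓ) → Edge S (v (inject₁ i)) (v (fsuc i)))

next : ∀ {n} → Fin (suc n) → Fin (suc n)
next {n} i = fromℕ< (m%n<n (suc (toℕ i)) (suc n))

-- cycle of length ℓ = suc n: ℓ distinct vertices, v i adjacent to v (i+1 mod ℓ)
IsCycle : (FinSub → Set) → (n : ℕ) → (Fin (suc n) → ℕ) → Set
IsCycle S n v = Injective _≡_ _≡_ v × (∀ i → Edge S (v i) (v (next i)))

ComponentIsCycleGraph : (FinSub → Set) → (n : ℕ) → (Fin (suc n) → ℕ) → Set
ComponentIsCycleGraph S n v =
  (∀ x → Connected S (v Fin.zero) x → ∃ λ i → x ≡ v i) ×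
  (∀ i j → Edge S (v i) (v j) → (j ≡ next i) Data.Sum.⊎ (i ≡ next j))
  where import Data.Fin as Fin
        import Data.Sum

-- In an HFS any two factorizations of the same set have the same length.
-- A family of two-element quarks in which every block has a vertex lying in
-- no other block is irredundant, hence a factorization of its union.  A path
-- v₀ … v₅ therefore gives the factorizations {v₀v₁, v₂v₃, v₄v₅} and
-- {v₀v₁, v₂v₁, v₃v₄, v₅v₄} of {v₀, …, v₅}, of lengths 3 and 4; a triangle
-- abc with a pendant edge wa gives {wa, bc} and {wa, ba, ca}, of lengths 2
-- and 3.  A component containing a 3- or 5-cycle that is not the cycle
-- itself has a neighbour outside the cycle or a chord, and either creates
-- one of these two configurations.
module Submission where

open import Defs
open import Data.Nat using (ℕ; suc)
open import Data.Nat.Properties using () renaming (_≟_ to _≟ℕ_)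
open import Data.Fin using (Fin; zero; suc; inject₁)
open import Data.Fin.Patterns using (0F; 1F; 2F; 3F; 4F; 5F)
open import Data.Fin.Properties using (_≟_; any?; all?)
open import Data.Product using (Σ; ∃; _×_; _,_; proj₁; proj₂)
open import Data.Sum using (_⊎_; inj₁; inj₂; [_,_])
open import Data.Empty using (⊥; ⊥-elim)
open import Data.List using (List; []; _∷_; length; tabulate)
open import Data.List.Properties using (length-tabulate)
open import Data.List.Membership.Propositional using (_∈_; find; lose)
open import Data.List.Membership.Propositional.Properties
  using (∈-concat⁺′; ∈-concat⁻′; ∈-tabulate⁺; ∈-tabulate⁻)
open import Data.List.Relation.Unary.Any using (here; there)
open import Data.List.Relation.Unary.All as All using (All; []; _∷_)
open import Data.List.Relation.Unary.All.Properties using () renaming (tabulate⁺ to All-tabulate⁺)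
open import Data.List.Relation.Unary.AllPairs.Properties using () renaming (tabulate⁺ to AllPairs-tabulate⁺)
import Data.Vec.Functional as Vector
open import Function using (_∘_; case_of_)
open import Function.Definitions using (Injective)
open import Relation.Nullary using (¬_; Dec; yes; no)
open import Relation.Nullary.Decidable using (from-yes; ¬?; _×-dec_; _⊎-dec_; _→-dec_)
open import Relation.Binary.PropositionalEquality using (_≡_; _≢_; refl; sym; trans; cong; subst; module ≡-Reasoning)
open import Relation.Binary.Construct.Closure.ReflexiveTransitive using (ε; _◅_)

private variable
  S : FinSub → Set
  A B C X : FinSub
  z z′ : List FinSub
  a b x y : ℕ
  k l m n : ℕ

≐-refl : A ≐ A
≐-refl = (λ _ x∈ → x∈) , (λ _ x∈ → x∈)

≐-sym : A ≐ B → B ≐ A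
≐-sym (A⊆B , B⊆A) = B⊆A , A⊆B

≐-trans : A ≐ B → B ≐ C → A ≐ C
≐-trans (A⊆B , B⊆A) (B⊆C , C⊆B) = (λ x → B⊆C x ∘ A⊆B x) , (λ x → B⊆A x ∘ C⊆B x)

∈-pair⁻ : x ∈ a ∷ b ∷ [] → x ≡ a ⊎ x ≡ b
∈-pair⁻ (here x≡a)         = inj₁ x≡a
∈-pair⁻ (there (here x≡b)) = inj₂ x≡b

pair-comm : (a ∷ b ∷ []) ≐ (b ∷ a ∷ [])
pair-comm = swap , swap
  where
  swap : ∀ {a b} x → x ∈ a ∷ b ∷ [] → x ∈ b ∷ a ∷ []
  swap x (here x≡a)         = there (here x≡a)
  swap x (there (here x≡b)) = here x≡b

Quark-resp-≐ : BooleanSublattice S → A ≐ B → Quark S A → Quark S B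
Quark-resp-≐ {A = A} {B = B} lattice A≐B (A∈S , (x , x∈A) , minimal) =
  BooleanSublattice.respects lattice A B A≐B A∈S , (x , proj₁ A≐B x x∈A) ,
  λ { (C , C∈S , ∅⊊C , (C⊆B , C≉B)) →
        minimal (C , C∈S , ∅⊊C , (λ y → proj₂ A≐B y ∘ C⊆B y) , λ C≐A → C≉B (≐-trans C≐A A≐B)) }

Edge-sym : BooleanSublattice S → Edge S a b → Edge S b a
Edge-sym lattice (a≢b , quark) = a≢b ∘ sym , Quark-resp-≐ lattice pair-comm quark

⋃-closed : BooleanSublattice S → All S z → S (⋃ z)
⋃-closed lattice []          = BooleanSublattice.hasEmpty lattice
⋃-closed lattice (A∈S ∷ z⊆S) = BooleanSublattice.closed∪ lattice _ _ A∈S (⋃-closed lattice z⊆S)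

factorized⇒∈ : BooleanSublattice S → Factorization S X z → S X
factorized⇒∈ lattice (_ , quarks , ⋃z≐X , _) =
  BooleanSublattice.respects lattice _ _ ⋃z≐X (⋃-closed lattice (All.map proj₁ quarks))

HFS⇒factorizations-same-length : BooleanSublattice S → IsHFS S → Nonempty X →
  Factorization S X z → Factorization S X z′ → length z ≡ length z′
HFS⇒factorizations-same-length {z = z} {z′ = z′} lattice hfs X≠∅ fz fz′
  with hfs _ (factorized⇒∈ lattice fz) X≠∅
... | _ , _ , unique = trans (unique _ (z , fz , refl)) (sym (unique _ (z′ , fz′ , refl)))

HasPrivatePoints : (Fin k → FinSub) → Set
HasPrivatePoints f = ∀ a → ∃ λ x → x ∈ f a × (∀ b → x ∈ f b → a ≡ b)

∈̃-tabulate⁻ : {f : Fin k → FinSub} → A ∈̃ tabulate f → ∃ λ a → A ≐ f a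
∈̃-tabulate⁻ A∈̃ with find A∈̃
... | _ , B∈ , A≐B with ∈-tabulate⁻ B∈
... | a , refl = a , A≐B

private-points⇒irredundant : {f : Fin k → FinSub} → HasPrivatePoints f →
  ⋃ (tabulate f) ≐ X → ∀ z′ → z′ ⊏ tabulate f → ⋃ z′ ⊊ˢ X
private-points⇒irredundant {X = X} {f = f} privacy (⋃⊆X , _) z′ (z′⊑z , z⋢z′) =
  ⋃z′⊆X , λ ⋃z′≐X → z⋢z′ (covering⇒⊒ ⋃z′≐X)
  where
  member : ∀ {B} → B ∈ z′ → ∃ λ a → B ≐ f a
  member B∈z′ = ∈̃-tabulate⁻ (z′⊑z _ (lose B∈z′ ≐-refl))

  ⋃z′⊆X : ⋃ z′ ⊆ˢ X
  ⋃z′⊆X x x∈ with ∈-concat⁻′ z′ x∈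
  ... | B , x∈B , B∈z′ with member B∈z′
  ... | a , B≐fa = ⋃⊆X x (∈-concat⁺′ (proj₁ B≐fa x x∈B) (∈-tabulate⁺ a))

  -- The private point of f a lies in ⋃ z′, so z′ has a member equal to f a.
  covering⇒⊒ : ⋃ z′ ≐ X → tabulate f ⊑ z′
  covering⇒⊒ (_ , X⊆⋃z′) A A∈̃ with ∈̃-tabulate⁻ A∈̃
  ... | a , A≐fa with privacy a
  ... | x , x∈fa , only-a
    with ∈-concat⁻′ z′ (X⊆⋃z′ x (⋃⊆X x (∈-concat⁺′ x∈fa (∈-tabulate⁺ a))))
  ... | B , x∈B , B∈z′ with member B∈z′
  ... | b , B≐fb with only-a b (proj₁ B≐fb x x∈B)
  ... | refl = lose B∈z′ (≐-trans A≐fa (≐-sym B≐fb))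

private-points⇒factorization : {f : Fin k → FinSub} → HasPrivatePoints f →
  (∀ a → Quark S (f a)) → ⋃ (tabulate f) ≐ X → Factorization S X (tabulate f)
private-points⇒factorization privacy quarks ⋃≐X =
  AllPairs-tabulate⁺ distinct , All-tabulate⁺ quarks , ⋃≐X ,
  private-points⇒irredundant privacy ⋃≐X
  where
  distinct : ∀ {a b} → a ≢ b → ¬ _ ≐ _
  distinct {a} {b} a≢b (fa⊆fb , _) with privacy a
  ... | x , x∈fa , only-a = a≢b (only-a b (fa⊆fb x x∈fa))

-- Block a is {proj₁ (P a), proj₂ (P a)}; its first vertex is to be private.
Pattern : ℕ → ℕ → Set
Pattern k n = Fin k → Fin n × Fin n

WellFormed : Pattern k n → Set
WellFormed P =
  (∀ a b → proj₁ (P a) ≡ proj₁ (P b) → a ≡ b) ×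
  (∀ a b → proj₁ (P a) ≢ proj₂ (P b)) ×
  (∀ i → ∃ λ a → i ≡ proj₁ (P a) ⊎ i ≡ proj₂ (P a))

wellFormed? : (P : Pattern k n) → Dec (WellFormed P)
wellFormed? P =
  (all? λ a → all? λ b → (proj₁ (P a) ≟ proj₁ (P b)) →-dec (a ≟ b)) ×-dec
  (all? λ a → all? λ b → ¬? (proj₁ (P a) ≟ proj₂ (P b))) ×-dec
  (all? λ i → any? λ a → (i ≟ proj₁ (P a)) ⊎-dec (i ≟ proj₂ (P a)))

blocks : (Fin n → ℕ) → Pattern k n → Fin k → FinSub
blocks u P a = u (proj₁ (P a)) ∷ u (proj₂ (P a)) ∷ []

BlocksAreEdges : (FinSub → Set) → (Fin n → ℕ) → Pattern k n → Set
BlocksAreEdges S u P = ∀ a → Edge S (u (proj₁ (P a))) (u (proj₂ (P a)))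

pattern-factorization : {u : Fin n → ℕ} {P : Pattern k n} → Injective _≡_ _≡_ u →
  WellFormed P → BlocksAreEdges S u P → Factorization S (tabulate u) (tabulate (blocks u P))
pattern-factorization {u = u} {P = P} u-inj (private-inj , private≢partner , covers) edges =
  private-points⇒factorization privacy (proj₂ ∘ edges) (⋃⊆ , ⊆⋃)
  where
  privacy : HasPrivatePoints (blocks u P)
  privacy a = u (proj₁ (P a)) , here refl ,
    λ b x∈ → [ (λ e → private-inj a b (u-inj e)) , (λ e → ⊥-elim (private≢partner a b (u-inj e))) ]
               (∈-pair⁻ x∈)

  ⋃⊆ : ⋃ (tabulate (blocks u P)) ⊆ˢ tabulate u
  ⋃⊆ x x∈ with ∈-concat⁻′ (tabulate (blocks u P)) x∈
  ... | _ , x∈B , B∈ with ∈-tabulate⁻ B∈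
  ... | a , refl with ∈-pair⁻ x∈B
  ... | inj₁ refl = ∈-tabulate⁺ _
  ... | inj₂ refl = ∈-tabulate⁺ _

  ⊆⋃ : tabulate u ⊆ˢ ⋃ (tabulate (blocks u P))
  ⊆⋃ x x∈ with ∈-tabulate⁻ x∈
  ... | i , refl with covers i
  ... | a , inj₁ refl = ∈-concat⁺′ (here refl) (∈-tabulate⁺ a)
  ... | a , inj₂ refl = ∈-concat⁺′ (there (here refl)) (∈-tabulate⁺ a)

patterns-same-size : BooleanSublattice S → IsHFS S →
  {u : Fin (suc n) → ℕ} → Injective _≡_ _≡_ u →
  (P : Pattern k (suc n)) (Q : Pattern l (suc n)) → WellFormed P → WellFormed Q →
  BlocksAreEdges S u P → BlocksAreEdges S u Q → k ≡ l
patterns-same-size {k = k} {l = l} lattice hfs {u} u-inj P Q P-wf Q-wf P-edges Q-edges = begin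
  k                                ≡⟨ sym (length-tabulate (blocks u P)) ⟩
  length (tabulate (blocks u P))   ≡⟨ HFS⇒factorizations-same-length lattice hfs (u zero , here refl)
                                        (pattern-factorization u-inj P-wf P-edges)
                                        (pattern-factorization u-inj Q-wf Q-edges) ⟩
  length (tabulate (blocks u Q))   ≡⟨ length-tabulate (blocks u Q) ⟩
  l                                ∎
  where open ≡-Reasoning

no-path-of-length-5 : BooleanSublattice S → IsHFS S → ¬ Σ (Fin 6 → ℕ) (IsPath S 5)
no-path-of-length-5 lattice hfs (v , v-inj , edge) =
  case patterns-same-size lattice hfs v-inj P Q
         (from-yes (wellFormed? P)) (from-yes (wellFormed? Q)) P-edges Q-edges of λ ()
  where
  P : Pattern 3 6
  P 0F = 0F , 1F
  P 1F = 2F , 3F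
  P 2F = 4F , 5F

  Q : Pattern 4 6
  Q 0F = 0F , 1F
  Q 1F = 2F , 1F
  Q 2F = 3F , 4F
  Q 3F = 5F , 4F

  P-edges : BlocksAreEdges _ v P
  P-edges 0F = edge 0F
  P-edges 1F = edge 2F
  P-edges 2F = edge 4F

  Q-edges : BlocksAreEdges _ v Q
  Q-edges 0F = edge 0F
  Q-edges 1F = Edge-sym lattice (edge 1F)
  Q-edges 2F = edge 3F
  Q-edges 3F = Edge-sym lattice (edge 4F)

-- The path u₀u₁u₂u₃ with the chord u₁u₃ is the triangle u₁u₂u₃ with the pendant edge u₀u₁.
no-pendant-triangle : BooleanSublattice S → IsHFS S → {u : Fin 4 → ℕ} →
  IsPath S 3 u → Edge S (u 1F) (u 3F) → ⊥
no-pendant-triangle lattice hfs {u} (u-inj , edge) chord =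
  case patterns-same-size lattice hfs u-inj P Q
         (from-yes (wellFormed? P)) (from-yes (wellFormed? Q)) P-edges Q-edges of λ ()
  where
  P : Pattern 2 4
  P 0F = 0F , 1F
  P 1F = 2F , 3F

  Q : Pattern 3 4
  Q 0F = 0F , 1F
  Q 1F = 2F , 1F
  Q 2F = 3F , 1F

  P-edges : BlocksAreEdges _ u P
  P-edges 0F = edge 0F
  P-edges 1F = edge 2F

  Q-edges : BlocksAreEdges _ u Q
  Q-edges 0F = edge 0F
  Q-edges 1F = Edge-sym lattice (edge 1F)
  Q-edges 2F = Edge-sym lattice chord

orbit : Fin (suc n) → Fin m → Fin (suc n)
orbit j zero    = j
orbit j (suc i) = next (orbit j i)

orbit-inject₁ : (j : Fin (suc n)) (i : Fin m) → orbit j (inject₁ i) ≡ orbit j i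
orbit-inject₁ j zero    = refl
orbit-inject₁ j (suc i) = cong next (orbit-inject₁ j i)

OrbitsInjective : ℕ → ℕ → Set
OrbitsInjective n m = ∀ (j : Fin (suc n)) (a b : Fin m) → orbit j a ≡ orbit j b → a ≡ b

orbitsInjective? : ∀ n m → Dec (OrbitsInjective n m)
orbitsInjective? n m = all? λ j → all? λ a → all? λ b → (orbit j a ≟ orbit j b) →-dec (a ≟ b)

orbit-path : {v : Fin (suc n) → ℕ} → IsCycle S n v → OrbitsInjective n (suc m) →
  ∀ j → IsPath S m (v ∘ orbit j)
orbit-path {S = S} {v = v} (v-inj , edge) orbit-inj j =
  (λ {a} {b} e → orbit-inj j a b (v-inj e)) ,
  λ i → subst (λ w → Edge S (v w) (v (next (orbit j i)))) (sym (orbit-inject₁ j i)) (edge (orbit j i))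

∷-injective : {u : Fin m → ℕ} → (∀ i → y ≢ u i) → Injective _≡_ _≡_ u →
  Injective _≡_ _≡_ (y Vector.∷ u)
∷-injective fresh u-inj {zero}  {zero}  _   = refl
∷-injective fresh u-inj {zero}  {suc j} y≡ = ⊥-elim (fresh j y≡)
∷-injective fresh u-inj {suc i} {zero}  ≡y = ⊥-elim (fresh i (sym ≡y))
∷-injective fresh u-inj {suc i} {suc j} e  = cong suc (u-inj e)

path-extend : {u : Fin (suc m) → ℕ} → IsPath S m u → (∀ i → y ≢ u i) → Edge S y (u zero) →
  IsPath S (suc m) (y Vector.∷ u)
path-extend (u-inj , edge) fresh y~u₀ =
  ∷-injective fresh u-inj , λ { zero → y~u₀ ; (suc i) → edge i }

component⊆image : {v : Fin (suc n) → ℕ} →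
  (∀ {j y} → Edge S (v j) y → ¬ (∀ k → y ≢ v k)) →
  ∀ {i} x → Connected S (v i) x → ∃ λ k → x ≡ v k
component⊆image no-fresh x ε = _ , refl
component⊆image {v = v} no-fresh x (_◅_ {j = y} v~y y⇝x)
  with any? (λ k → y ≟ℕ v k)
... | yes (k , refl) = component⊆image no-fresh x y⇝x
... | no y∉v         = ⊥-elim (no-fresh v~y (λ k y≡ → y∉v (k , y≡)))

next³≡id : (j : Fin 3) → next (next (next j)) ≡ j
next³≡id 0F = refl
next³≡id 1F = refl
next³≡id 2F = refl

triangle-pairs : (i j : Fin 3) → i ≡ j ⊎ j ≡ next i ⊎ i ≡ next j
triangle-pairs = from-yes (all? λ (i : Fin 3) → all? λ j → (i ≟ j) ⊎-dec (j ≟ next i) ⊎-dec (i ≟ next j))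

triangle-component : BooleanSublattice S → IsHFS S → {v : Fin 3 → ℕ} →
  IsCycle S 2 v → ComponentIsCycleGraph S 2 v
triangle-component {S = S} lattice hfs {v} cycle@(_ , edge) =
  component⊆image no-fresh , no-chord
  where
  no-fresh : ∀ {j y} → Edge S (v j) y → ¬ (∀ k → y ≢ v k)
  no-fresh {j} v~y fresh =
    no-pendant-triangle lattice hfs
      (path-extend (orbit-path cycle (from-yes (orbitsInjective? 2 3)) j)
                   (fresh ∘ orbit j) (Edge-sym lattice v~y))
      (Edge-sym lattice (subst (λ w → Edge S (v (next (next j))) (v w)) (next³≡id j) (edge (next (next j)))))

  no-chord : ∀ i j → Edge S (v i) (v j) → j ≡ next i ⊎ i ≡ next j
  no-chord i j (vi≢vj , _) with triangle-pairs i j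
  ... | inj₁ refl     = ⊥-elim (vi≢vj refl)
  ... | inj₂ adjacent = adjacent

DistanceTwo : Fin 5 → Fin 5 → Set
DistanceTwo i j = ∃ λ k → i ≡ next k × j ≡ next (next (next k))

pentagon-pairs : (i j : Fin 5) → i ≡ j ⊎ (j ≡ next i ⊎ i ≡ next j) ⊎ (DistanceTwo i j ⊎ DistanceTwo j i)
pentagon-pairs = from-yes (all? λ (i : Fin 5) → all? λ j →
  (i ≟ j) ⊎-dec ((j ≟ next i) ⊎-dec (i ≟ next j)) ⊎-dec (distanceTwo? i j ⊎-dec distanceTwo? j i))
  where
  distanceTwo? : ∀ i j → Dec (DistanceTwo i j)
  distanceTwo? i j = any? λ k → (i ≟ next k) ×-dec (j ≟ next (next (next k)))

pentagon-component : BooleanSublattice S → IsHFS S → {v : Fin 5 → ℕ} →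
  IsCycle S 4 v → ComponentIsCycleGraph S 4 v
pentagon-component {S = S} lattice hfs {v} cycle =
  component⊆image no-fresh , no-chord
  where
  no-fresh : ∀ {j y} → Edge S (v j) y → ¬ (∀ k → y ≢ v k)
  no-fresh {j} v~y fresh =
    no-path-of-length-5 lattice hfs
      (_ , path-extend (orbit-path cycle (from-yes (orbitsInjective? 4 5)) j)
                       (fresh ∘ orbit j) (Edge-sym lattice v~y))

  chord⇒⊥ : ∀ {i j} → DistanceTwo i j → Edge S (v i) (v j) → ⊥
  chord⇒⊥ (k , refl , refl) =
    no-pendant-triangle lattice hfs (orbit-path cycle (from-yes (orbitsInjective? 4 4)) k)

  no-chord : ∀ i j → Edge S (v i) (v j) → j ≡ next i ⊎ i ≡ next j
  no-chord i j vi~vj@(vi≢vj , _) with pentagon-pairs i j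
  ... | inj₁ refl               = ⊥-elim (vi≢vj refl)
  ... | inj₂ (inj₁ adjacent)    = adjacent
  ... | inj₂ (inj₂ (inj₁ i⋯j)) = ⊥-elim (chord⇒⊥ i⋯j vi~vj)
  ... | inj₂ (inj₂ (inj₂ j⋯i)) = ⊥-elim (chord⇒⊥ j⋯i (Edge-sym lattice vi~vj))

lemma5p3 : (S : FinSub → Set) → BooleanSublattice S →
    (∀ A → Quark S A → HasSize2 A) → IsHFS S →
    (¬ (Σ (Fin 6 → ℕ) λ v → IsPath S 5 v)) ×
    (∀ (v : Fin 3 → ℕ) → IsCycle S 2 v → ComponentIsCycleGraph S 2 v) ×
    (∀ (v : Fin 5 → ℕ) → IsCycle S 4 v → ComponentIsCycleGraph S 4 v)
lemma5p3 S lattice _ hfs =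
  no-path-of-length-5 lattice hfs ,
  (λ v → triangle-component lattice hfs) ,
  (λ v → pentagon-component lattice hfs)
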